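{- Let $e$ be a normal expression of the split fireball calculus. For any type derivation $\pi\triangleright\Gamma\vdash e:M$ one has $|e|\leq|\Gamma|+|M|$. If moreover $e$ is an inert term, then $|e|+|M|\leq|\Gamma|$.
   Context: Terms: $t,u ::= x \mid \lambda x.t \mid tu$, up to $\alpha$-equivalence; $t\{x\leftarrow u\}$ is capture-avoiding substitution. Values: $v ::= x \mid \lambda x.t$. Fireballs $f$ and inert terms $i$ are defined by mutual induction: $f ::= v \mid i$ and $i ::= x f_1 \dots f_n$ with $n>0$ (application left-associative). Right evaluation contexts: $C ::= \langle\cdot\rangle \mid t\,C \mid C\,f$. Split fireball calculus: environments $E ::= \epsilon \mid [x\leftarrow i]:E$; programs $p=(t,E)$; expressions are terms or programs. Reduction: $(C\langle(\lambda x.t)v\rangle,E)\to_{\beta_v}(C\langle t\{x\leftarrow v\}\rangle,E)$ and $(C\langle(\lambda x.t)i\rangle,E)\to_{\beta_i}(C\langle t\rangle,[x\leftarrow i]:E)$; $\to_{\beta_f}=\to_{\beta_v}\cup\to_{\beta_i}$. A program is normal if it has no $\to_{\beta_f}$-reduct; a normal expression is a normal program or a term $t$ such that $(t,E)$ is normal for every environment $E$. Append: $\epsilon@[x\leftarrow i]=[x\leftarrow i]$, $([y\leftarrow i']:E)@[x\leftarrow i]=[y\leftarrow i']:(E@[x\leftarrow i])$. Sizes: $|v|=0$, $|tu|=|t|+|u|+1$, $|(t,\epsilon)|=|t|$, $|(t,E@[x\leftarrow i])|=|(t,E)|+|i|$. Multi types: linear types $L ::= M\multimap N$; multi types $M,N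 ::= [L_1,\dots,L_n]$ (finite multisets, $n\ge 0$); $\mathbf 0$ empty multiset, $\uplus$ multiset sum. Type context $\Gamma$: total map from variables to multi types with finite $\mathrm{dom}(\Gamma)=\{x\mid \Gamma(x)\ne\mathbf 0\}$; $(\Gamma\uplus\Delta)(x)=\Gamma(x)\uplus\Delta(x)$; $x:M$ maps $x$ to $M$ and all else to $\mathbf 0$; $\Gamma,x:M$ extends $\Gamma$ ($x\notin\mathrm{dom}(\Gamma)$) by $x\mapsto M$. Typing rules: (ax) $x:M\vdash x:M$; (@) from $\Gamma\vdash t:[M\multimap N]$ and $\Delta\vdash u:M$ infer $\Gamma\uplus\Delta\vdash tu:N$; ($\lambda$) from $\Gamma_k,x:M_k\vdash t:N_k$ for $k=1,\dots,n$ ($n\ge0$) infer $\Gamma_1\uplus\dots\uplus\Gamma_n\vdash\lambda x.t:[M_1\multimap N_1,\dots,M_n\multimap N_n]$; (es$_\epsilon$) from $\Gamma\vdash t:M$ infer $\Gamma\vdash (t,\epsilon):M$; (es$_@$) from $\Gamma,x:M\vdash(t,E):N$ and $\Delta\vdash i:M$ infer $\Gamma\uplus\Delta\vdash(t,E@[x\leftarrow i]):N$. Type sizes: $|M\multimap N|=1+|M|+|N|$, $|[L_1,\dots,L_n]|=\sum_k|L_k|$, and for a context $|\Gamma|=\sum_x|\Gamma(x)|$ (the sum of the sizes of the multi types in $\Gamma$). -}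

module Defs where

open import Data.Nat using (ℕ; zero; suc; _+_; _∸_; _≤_; _<ᵇ_; _≡ᵇ_)
open import Data.Bool using (Bool; true; false; if_then_else_)
open import Data.List using (List; []; _∷_; _++_; map; foldr; replicate)
open import Data.Nat.ListAction using (sum)
open import Data.List.Relation.Unary.All using (All)
open import Data.Product using (Σ; _×_; _,_; proj₁; proj₂)
open import Relation.Nullary using (¬_)

-- Terms, in de Bruijn notation (so α-equivalent terms are identical).
-- var k is the variable with de Bruijn index k.

data Tm : Set where
  var : ℕ → Tm
  lam : Tm → Tm
  app : Tm → Tm → Tm

data Value : Tm → Set where
  var : ∀ k → Value (var k)
  lam : ∀ t → Value (lam t)

mutual
  data Fireball : Tm → Set where
    val   : ∀ {t} → Value t → Fireball t
    inert : ∀ {t} → Inert t → Fireball t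

  data Inert : Tm → Set where
    var-app : ∀ {f} k → Fireball f → Inert (app (var k) f)
    app     : ∀ {i f} → Inert i → Fireball f → Inert (app i f)

↑ : ℕ → Tm → Tm
↑ c (var k)   = if k <ᵇ c then var k else var (suc k)
↑ c (lam t)   = lam (↑ (suc c) t)
↑ c (app t u) = app (↑ c t) (↑ c u)

-- capture-avoiding substitution of s for index j, removing the binder:
-- inst j s t  realises  t{x←s} for the λ-bound x at index j
inst : ℕ → Tm → Tm → Tm
inst j s (var k)   = if k ≡ᵇ j then s else (if j <ᵇ k then var (k ∸ 1) else var k)
inst j s (lam t)   = lam (inst (suc j) (↑ 0 s) t)
inst j s (app t u) = app (inst j s t) (inst j s u)

data RC : Set where
  hole : RC
  appL : Tm → RC → RC
  appR : RC → Tm → RC          -- C f   (f must be a fireball, see IsRC)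

data IsRC : RC → Set where
  hole : IsRC hole
  appL : ∀ {t C} → IsRC C → IsRC (appL t C)
  appR : ∀ {C f} → IsRC C → Fireball f → IsRC (appR C f)

plug : RC → Tm → Tm
plug hole t       = t
plug (appL u C) t = app u (plug C t)
plug (appR C f) t = app (plug C t) f

-- shift every term in a context (used when a new binder is added to the
-- environment; evaluation contexts contain no binders around the hole)
↑C : RC → RC
↑C hole       = hole
↑C (appL u C) = appL (↑ 0 u) (↑C C)
↑C (appR C f) = appR (↑C C) (↑ 0 f)

-- An environment [x₁←i₁]:…:[xₙ←iₙ] is the list of its inert terms
-- (first element = x₁).  In t, index 0 is x₁, …, index n-1 is xₙ, and
-- index n+k is the k-th free variable of the program.  In iₖ, index 0 is
-- x_{k+1}, etc.  E @ [x←i] is  E ++ (i , _) ∷ [].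

Env : Set
Env = List (Σ Tm Inert)

record Prog : Set where
  constructor ⟨_,_⟩
  field
    term : Tm
    env  : Env

_++[_] : Env → Σ Tm Inert → Env
E ++[ i ] = E ++ (i ∷ [])

data _→βf_ : Prog → Prog → Set where
  βv : ∀ {C t v E} → IsRC C → Value v →
       ⟨ plug C (app (lam t) v) , E ⟩ →βf ⟨ plug C (inst 0 v t) , E ⟩
  βi : ∀ {C t i E} → IsRC C → (ii : Inert i) →
       ⟨ plug C (app (lam t) i) , E ⟩ →βf ⟨ plug (↑C C) t , (i , ii) ∷ E ⟩

NormalProg : Prog → Set
NormalProg p = ¬ (Σ Prog λ q → p →βf q)

data Expr : Set where
  tm   : Tm → Expr
  prog : Prog → Expr

NormalExpr : Expr → Set
NormalExpr (tm t)   = (E : Env) → NormalProg ⟨ t , E ⟩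
NormalExpr (prog p) = NormalProg p

∣_∣t : Tm → ℕ
∣ var _ ∣t   = 0
∣ lam _ ∣t   = 0
∣ app t u ∣t = ∣ t ∣t + ∣ u ∣t + 1

∣_∣p : Prog → ℕ
∣ ⟨ t , E ⟩ ∣p = foldr (λ i n → n + ∣ proj₁ i ∣t) ∣ t ∣t E

∣_∣e : Expr → ℕ
∣ tm t ∣e   = ∣ t ∣t
∣ prog p ∣e = ∣ p ∣p

-- Multi types.  Multisets are represented by lists, taken up to the
-- (nested) multiset equality _≈M_ below.

data Lin : Set where
  _⊸_ : List Lin → List Lin → Lin

MT : Set
MT = List Lin

mutual
  data _≈L_ : Lin → Lin → Set where
    ⊸-cong : ∀ {M M' N N'} → M ≈M M' → N ≈M N' → (M ⊸ N) ≈L (M' ⊸ N')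

  data _≈M_ : MT → MT → Set where
    []    : [] ≈M []
    prep  : ∀ {L L' M M'} → L ≈L L' → M ≈M M' → (L ∷ M) ≈M (L' ∷ M')
    swap  : ∀ {L L' M} → (L ∷ L' ∷ M) ≈M (L' ∷ L ∷ M)
    trans : ∀ {M N P} → M ≈M N → N ≈M P → M ≈M P

mutual
  ∣_∣L : Lin → ℕ
  ∣ M ⊸ N ∣L = 1 + ∣ M ∣M + ∣ N ∣M

  ∣_∣M : MT → ℕ
  ∣ [] ∣M    = 0
  ∣ L ∷ M ∣M = ∣ L ∣L + ∣ M ∣M

-- Type contexts: Γ is a list, Γ(k) is its k-th entry (𝟎 = [] beyond the end).
-- Its domain is finite by construction.

TCtx : Set
TCtx = List MT

_⟨_⟩ : TCtx → ℕ → MT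
[] ⟨ _ ⟩          = []
(M ∷ Γ) ⟨ zero ⟩  = M
(M ∷ Γ) ⟨ suc k ⟩ = Γ ⟨ k ⟩

_≈Γ_ : TCtx → TCtx → Set
Γ ≈Γ Δ = ∀ k → (Γ ⟨ k ⟩) ≈M (Δ ⟨ k ⟩)

_⊎Γ_ : TCtx → TCtx → TCtx
[] ⊎Γ Δ            = Δ
(M ∷ Γ) ⊎Γ []      = M ∷ Γ
(M ∷ Γ) ⊎Γ (N ∷ Δ) = (M ++ N) ∷ (Γ ⊎Γ Δ)

⨄ : List TCtx → TCtx
⨄ = foldr _⊎Γ_ []

_∶_ctx : ℕ → MT → TCtx
k ∶ M ctx = replicate k [] ++ (M ∷ [])

-- Γ = Θ(0)-part and the rest: Θ = (tl Θ) , 0 : hd Θ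
hd : TCtx → MT
hd Θ = Θ ⟨ 0 ⟩

tl : TCtx → TCtx
tl []      = []
tl (_ ∷ Θ) = Θ

∣_∣Γ : TCtx → ℕ
∣ Γ ∣Γ = sum (map ∣_∣M Γ)

-- Typing rules.  Judgements are taken up to multiset equality of the
-- types and contexts (rules conv / conv-p), since multisets are
-- represented by lists.

mutual
  data _⊢_∶_ : TCtx → Tm → MT → Set where
    ax   : ∀ k M → (k ∶ M ctx) ⊢ var k ∶ M
    app-r : ∀ {Γ Δ t u M N} → Γ ⊢ t ∶ ((M ⊸ N) ∷ []) → Δ ⊢ u ∶ M →
           (Γ ⊎Γ Δ) ⊢ app t u ∶ N
    -- premises Γₖ , x : Mₖ ⊢ t : Nₖ  (k = 1..n), written Θₖ ⊢ t : Nₖ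
    λ-r  : ∀ {t} (ps : List (TCtx × MT)) →
           All (λ p → proj₁ p ⊢ t ∶ proj₂ p) ps →
           ⨄ (map (λ p → tl (proj₁ p)) ps) ⊢ lam t ∶ map (λ p → hd (proj₁ p) ⊸ proj₂ p) ps
    conv : ∀ {Γ Γ' t M M'} → Γ ≈Γ Γ' → M ≈M M' → Γ ⊢ t ∶ M → Γ' ⊢ t ∶ M'

  data _⊢p_∶_ : TCtx → Prog → MT → Set where
    es-ε   : ∀ {Γ t M} → Γ ⊢ t ∶ M → Γ ⊢p ⟨ t , [] ⟩ ∶ M
    -- (es@) premise Γ , x : M ⊢ (t,E) : N written Θ ⊢ (t,E) : N with M = Θ(x)
    es-snoc  : ∀ {Θ Δ t E i N} → Θ ⊢p ⟨ t , E ⟩ ∶ N → Δ ⊢ proj₁ i ∶ hd Θ →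
             (tl Θ ⊎Γ Δ) ⊢p ⟨ t , E ++[ i ] ⟩ ∶ N
    conv-p : ∀ {Γ Γ' p M M'} → Γ ≈Γ Γ' → M ≈M M' → Γ ⊢p p ∶ M → Γ' ⊢p p ∶ M'

_⊢e_∶_ : TCtx → Expr → MT → Set
Γ ⊢e tm t ∶ M   = Γ ⊢ t ∶ M
Γ ⊢e prog p ∶ M = Γ ⊢p p ∶ M

-- Normal terms are fireballs. Along the spine of an inert term x f₁ … fₙ each application
-- consumes one arrow of the type of its head, and all these arrows come from the type of x
-- in Γ; so an inert term pays for both its size and its type out of Γ, and a fireball (an
-- inert term or a value of size 0) for its size out of Γ and M. A substitution [x←i] of an
-- environment adds |i| to the size and replaces x : Γ(x) by the context of i, which by the
-- inert bound is at least |i| + |Γ(x)|.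
module Submission where

open import Defs
open import Data.Nat using (_+_; _≤_)
open import Data.Product using (_×_)
open import Relation.Binary.PropositionalEquality using (_≡_)

open import Data.Nat using (suc; z≤n)
open import Data.Nat.Properties
  using (≤-trans; ≤-reflexive; +-monoˡ-≤; +-monoʳ-≤; m≤m+n; +-identityʳ; +-assoc;
         +-commutativeSemigroup; module ≤-Reasoning)
open import Data.Nat.Tactic.RingSolver using (solve-∀)
open import Algebra.Properties.CommutativeSemigroup +-commutativeSemigroup
  using (x∙yz≈y∙xz; xy∙z≈xz∙y; interchange)
open import Data.List using ([]; _∷_; _++_)
open import Data.Product using (Σ; proj₁; proj₂; _,_)
open import Data.Sum using (_⊎_; inj₁; inj₂)
open import Relation.Nullary using (contradiction)
open import Relation.Binary.PropositionalEquality
  using (refl; cong; cong₂; sym; subst₂) renaming (trans to ≡-trans)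

mutual
  ∣∣L-cong : ∀ {L L'} → L ≈L L' → ∣ L ∣L ≡ ∣ L' ∣L
  ∣∣L-cong (⊸-cong M≈M' N≈N') = cong₂ (λ m n → suc (m + n)) (∣∣M-cong M≈M') (∣∣M-cong N≈N')

  ∣∣M-cong : ∀ {M M'} → M ≈M M' → ∣ M ∣M ≡ ∣ M' ∣M
  ∣∣M-cong []                  = refl
  ∣∣M-cong (prep L≈L' M≈M')    = cong₂ _+_ (∣∣L-cong L≈L') (∣∣M-cong M≈M')
  ∣∣M-cong (swap {L} {L'} {M}) = x∙yz≈y∙xz ∣ L ∣L ∣ L' ∣L ∣ M ∣M
  ∣∣M-cong (trans M≈N N≈P)     = ≡-trans (∣∣M-cong M≈N) (∣∣M-cong N≈P)

∣∣Γ-cong : ∀ Γ Γ' → Γ ≈Γ Γ' → ∣ Γ ∣Γ ≡ ∣ Γ' ∣Γ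
∣∣Γ-cong []      []       Γ≈Γ' = refl
∣∣Γ-cong []      (_ ∷ Γ') Γ≈Γ' = cong₂ _+_ (∣∣M-cong (Γ≈Γ' 0)) (∣∣Γ-cong [] Γ' (λ k → Γ≈Γ' (suc k)))
∣∣Γ-cong (_ ∷ Γ) []       Γ≈Γ' = cong₂ _+_ (∣∣M-cong (Γ≈Γ' 0)) (∣∣Γ-cong Γ [] (λ k → Γ≈Γ' (suc k)))
∣∣Γ-cong (_ ∷ Γ) (_ ∷ Γ') Γ≈Γ' = cong₂ _+_ (∣∣M-cong (Γ≈Γ' 0)) (∣∣Γ-cong Γ Γ' (λ k → Γ≈Γ' (suc k)))

∣∣M-++ : ∀ M N → ∣ M ++ N ∣M ≡ ∣ M ∣M + ∣ N ∣M
∣∣M-++ []      N = refl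
∣∣M-++ (L ∷ M) N = ≡-trans (cong (∣ L ∣L +_) (∣∣M-++ M N)) (sym (+-assoc ∣ L ∣L ∣ M ∣M ∣ N ∣M))

∣∣Γ-⊎Γ : ∀ Γ Δ → ∣ Γ ⊎Γ Δ ∣Γ ≡ ∣ Γ ∣Γ + ∣ Δ ∣Γ
∣∣Γ-⊎Γ []      Δ       = refl
∣∣Γ-⊎Γ (M ∷ Γ) []      = sym (+-identityʳ _)
∣∣Γ-⊎Γ (M ∷ Γ) (N ∷ Δ) = ≡-trans (cong₂ _+_ (∣∣M-++ M N) (∣∣Γ-⊎Γ Γ Δ))
                                   (interchange ∣ M ∣M ∣ N ∣M ∣ Γ ∣Γ ∣ Δ ∣Γ)

∣∣Γ-∶ctx : ∀ k M → ∣ k ∶ M ctx ∣Γ ≡ ∣ M ∣M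
∣∣Γ-∶ctx 0       M = +-identityʳ _
∣∣Γ-∶ctx (suc k) M = ∣∣Γ-∶ctx k M

∣∣Γ-hd-tl : ∀ Θ → ∣ Θ ∣Γ ≡ ∣ hd Θ ∣M + ∣ tl Θ ∣Γ
∣∣Γ-hd-tl []      = refl
∣∣Γ-hd-tl (M ∷ Θ) = refl

∣∣p-++[] : ∀ t E i → ∣ ⟨ t , E ++[ i ] ⟩ ∣p ≡ ∣ ⟨ t , E ⟩ ∣p + ∣ proj₁ i ∣t
∣∣p-++[] t []      i = refl
∣∣p-++[] t (j ∷ E) i = ≡-trans (cong (_+ ∣ proj₁ j ∣t) (∣∣p-++[] t E i))
                               (xy∙z≈xz∙y ∣ ⟨ t , E ⟩ ∣p ∣ proj₁ i ∣t ∣ proj₁ j ∣t)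

var-bound : ∀ {Γ k M} → Γ ⊢ var k ∶ M → ∣ M ∣M ≤ ∣ Γ ∣Γ
var-bound (ax k M)                     = ≤-reflexive (sym (∣∣Γ-∶ctx k M))
var-bound (conv {Γ} {Γ'} Γ≈Γ' M≈M' ⊢x) =
  subst₂ _≤_ (∣∣M-cong M≈M') (∣∣Γ-cong Γ Γ' Γ≈Γ') (var-bound ⊢x)

app-bound : ∀ Γ Δ t u M N →
  ∣ t ∣t + ∣ (M ⊸ N) ∷ [] ∣M ≤ ∣ Γ ∣Γ → ∣ u ∣t ≤ ∣ Δ ∣Γ + ∣ M ∣M →
  ∣ app t u ∣t + ∣ N ∣M ≤ ∣ Γ ⊎Γ Δ ∣Γ
app-bound Γ Δ t u M N t-bound u-bound = begin
  ∣ t ∣t + ∣ u ∣t + 1 + ∣ N ∣M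
    ≤⟨ +-monoˡ-≤ ∣ N ∣M (+-monoˡ-≤ 1 (+-monoʳ-≤ ∣ t ∣t u-bound)) ⟩
  ∣ t ∣t + (∣ Δ ∣Γ + ∣ M ∣M) + 1 + ∣ N ∣M
    ≡⟨ rearrange ∣ t ∣t ∣ Δ ∣Γ ∣ M ∣M ∣ N ∣M ⟩
  ∣ t ∣t + ∣ (M ⊸ N) ∷ [] ∣M + ∣ Δ ∣Γ
    ≤⟨ +-monoˡ-≤ ∣ Δ ∣Γ t-bound ⟩
  ∣ Γ ∣Γ + ∣ Δ ∣Γ
    ≡⟨ sym (∣∣Γ-⊎Γ Γ Δ) ⟩
  ∣ Γ ⊎Γ Δ ∣Γ ∎
  where
  open ≤-Reasoning
  rearrange : ∀ a d m n → a + (d + m) + 1 + n ≡ a + ((1 + m + n) + 0) + d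
  rearrange = solve-∀

mutual
  inert-bound : ∀ {Γ t M} → Inert t → Γ ⊢ t ∶ M → ∣ t ∣t + ∣ M ∣M ≤ ∣ Γ ∣Γ
  inert-bound (var-app k f) (app-r {Γ} {Δ} {_} {u} {M} {N} ⊢x ⊢f) =
    app-bound Γ Δ (var k) u M N (var-bound ⊢x) (fireball-bound f ⊢f)
  inert-bound (app i f) (app-r {Γ} {Δ} {t} {u} {M} {N} ⊢i ⊢f) =
    app-bound Γ Δ t u M N (inert-bound i ⊢i) (fireball-bound f ⊢f)
  inert-bound {t = t} i (conv {Γ} {Γ'} Γ≈Γ' M≈M' ⊢t) =
    subst₂ (λ m g → ∣ t ∣t + m ≤ g) (∣∣M-cong M≈M') (∣∣Γ-cong Γ Γ' Γ≈Γ') (inert-bound i ⊢t)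

  fireball-bound : ∀ {Γ t M} → Fireball t → Γ ⊢ t ∶ M → ∣ t ∣t ≤ ∣ Γ ∣Γ + ∣ M ∣M
  fireball-bound (val (var k)) _ = z≤n
  fireball-bound (val (lam t)) _ = z≤n
  fireball-bound {Γ} {t} {M} (inert i) ⊢t =
    ≤-trans (m≤m+n ∣ t ∣t ∣ M ∣M) (≤-trans (inert-bound i ⊢t) (m≤m+n ∣ Γ ∣Γ ∣ M ∣M))

Reduces : Prog → Set
Reduces p = Σ Prog (p →βf_)

reduces-appL : ∀ {t u E} → Reduces (⟨ u , E ⟩) → Reduces (⟨ app t u , E ⟩)
reduces-appL {t} (_ , βv {C} C-rc v) = _ , βv {appL t C} (appL C-rc) v
reduces-appL {t} (_ , βi {C} C-rc i) = _ , βi {appL t C} (appL C-rc) i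

reduces-appR : ∀ {t u E} → Fireball u → Reduces (⟨ t , E ⟩) → Reduces (⟨ app t u , E ⟩)
reduces-appR {u = u} f (_ , βv {C} C-rc v) = _ , βv {appR C u} (appR C-rc f) v
reduces-appR {u = u} f (_ , βi {C} C-rc i) = _ , βi {appR C u} (appR C-rc f) i

reduces-redex : ∀ {t u E} → Fireball u → Reduces (⟨ app (lam t) u , E ⟩)
reduces-redex (val v)   = _ , βv {hole} hole v
reduces-redex (inert i) = _ , βi {hole} hole i

fireball-or-reduces : ∀ t E → Fireball t ⊎ Reduces (⟨ t , E ⟩)
fireball-or-reduces (var k)   E = inj₁ (val (var k))
fireball-or-reduces (lam t)   E = inj₁ (val (lam t))
fireball-or-reduces (app t u) E with fireball-or-reduces u E | fireball-or-reduces t E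
... | inj₂ u-red | _                  = inj₂ (reduces-appL u-red)
... | inj₁ f     | inj₂ t-red         = inj₂ (reduces-appR f t-red)
... | inj₁ f     | inj₁ (val (var k)) = inj₁ (inert (var-app k f))
... | inj₁ f     | inj₁ (val (lam b)) = inj₂ (reduces-redex f)
... | inj₁ f     | inj₁ (inert i)     = inj₁ (inert (app i f))

normal⇒fireball : ∀ {p} → NormalProg p → Fireball (Prog.term p)
normal⇒fireball {⟨ t , E ⟩} normal with fireball-or-reduces t E
... | inj₁ f   = f
... | inj₂ red = contradiction red normal

prog-bound : ∀ {Γ p M} → Fireball (Prog.term p) → Γ ⊢p p ∶ M → ∣ p ∣p ≤ ∣ Γ ∣Γ + ∣ M ∣M
prog-bound f (es-ε ⊢t) = fireball-bound f ⊢t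
prog-bound f (es-snoc {Θ} {Δ} {t} {E} {i} {N} ⊢p ⊢i) = begin
  ∣ ⟨ t , E ++[ i ] ⟩ ∣p
    ≡⟨ ∣∣p-++[] t E i ⟩
  ∣ ⟨ t , E ⟩ ∣p + ∣ proj₁ i ∣t
    ≤⟨ +-monoˡ-≤ ∣ proj₁ i ∣t (prog-bound f ⊢p) ⟩
  ∣ Θ ∣Γ + ∣ N ∣M + ∣ proj₁ i ∣t
    ≡⟨ cong (λ θ → θ + ∣ N ∣M + ∣ proj₁ i ∣t) (∣∣Γ-hd-tl Θ) ⟩
  ∣ hd Θ ∣M + ∣ tl Θ ∣Γ + ∣ N ∣M + ∣ proj₁ i ∣t
    ≡⟨ rearrange ∣ hd Θ ∣M ∣ tl Θ ∣Γ ∣ N ∣M ∣ proj₁ i ∣t ⟩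
  ∣ tl Θ ∣Γ + (∣ proj₁ i ∣t + ∣ hd Θ ∣M) + ∣ N ∣M
    ≤⟨ +-monoˡ-≤ ∣ N ∣M (+-monoʳ-≤ ∣ tl Θ ∣Γ (inert-bound (proj₂ i) ⊢i)) ⟩
  ∣ tl Θ ∣Γ + ∣ Δ ∣Γ + ∣ N ∣M
    ≡⟨ cong (_+ ∣ N ∣M) (sym (∣∣Γ-⊎Γ (tl Θ) Δ)) ⟩
  ∣ tl Θ ⊎Γ Δ ∣Γ + ∣ N ∣M ∎
  where
  open ≤-Reasoning
  rearrange : ∀ h l n i → h + l + n + i ≡ l + (i + h) + n
  rearrange = solve-∀
prog-bound {p = p} f (conv-p {Γ} {Γ'} Γ≈Γ' M≈M' ⊢p) =
  subst₂ (λ g m → ∣ p ∣p ≤ g + m) (∣∣Γ-cong Γ Γ' Γ≈Γ') (∣∣M-cong M≈M') (prog-bound f ⊢p)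

proposition7 : (e : Expr) → NormalExpr e → (Γ : TCtx) (M : MT) → Γ ⊢e e ∶ M →
    (∣ e ∣e ≤ ∣ Γ ∣Γ + ∣ M ∣M) ×
    ((i : Tm) → e ≡ tm i → Inert i → ∣ e ∣e + ∣ M ∣M ≤ ∣ Γ ∣Γ)
proposition7 (tm t) normal Γ M ⊢t =
  fireball-bound (normal⇒fireball (normal [])) ⊢t , λ { _ refl i → inert-bound i ⊢t }
proposition7 (prog p) normal Γ M ⊢p =
  prog-bound (normal⇒fireball normal) ⊢p , λ { _ () _ }
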